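{- Let $k\ge2$. For every integer $m\ge1$, \[D(m,k)=\begin{cases} d_0(m,k)+k\,D\!\left(\frac{m-1}{k},k\right), & \text{if } m-1 \text{ is a multiple of } k,\\ 1, & \text{otherwise.}\end{cases}\]
   Context: Fix an integer $k\ge 2$. Let $T_k$ be the infinite rooted $k$-ary tree (every vertex has exactly $k$ children) with one additional self-loop at the root, so every vertex has degree $k+1$. Chip-firing: a vertex with at least $k+1$ chips may fire, sending one chip along each incident edge (a non-root vertex sends one chip to its parent and one to each of its $k$ children; the root sends one chip to each of its $k$ children and one chip to itself along the self-loop). Starting with $N\ge0$ chips at the root and none elsewhere, vertices fire until no vertex can fire; this terminates, and the number of times each vertex fires does not depend on the order of firings. $f_0(N,k)$ denotes the number of root fires and $F(N,k)$ the total number of fires summed over all vertices (both $0$ for $N=0$). For integers $m\ge0$ define $g_0(m,k)=f_0(mk,k)$, $d_0(m,k)=g_0(m+1,k)-g_0(m,k)$, $G(m,k)=F(mk,k)$ and $D(m,k)=G(m+1,k)-G(m,k)$. -}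

module Defs where

open import Data.Nat using (ℕ; zero; suc; _+_; _*_; _∸_; _≤_; _<_)
open import Data.Fin using (Fin)
import Data.Fin.Properties as FinP
open import Data.List using (List; []; _∷_; length; filter)
import Data.List.Properties as ListP
open import Data.Bool using (Bool; true; false; if_then_else_)
open import Relation.Binary.PropositionalEquality using (_≡_)
open import Relation.Nullary using (Dec; yes; no; does)
open import Data.Product using (Σ; _×_)

-- Vertices of the infinite rooted k-ary tree T_k: a vertex is the list of
-- child indices on the path from it up to the root (root = []).
-- The children of v are  i ∷ v  (i : Fin k); the parent of  i ∷ v  is  v.
Vertex : ℕ → Set
Vertex k = List (Fin k)

root : {k : ℕ} → Vertex k
root = []

_≟V_ : {k : ℕ} → (v w : Vertex k) → Dec (v ≡ w)
_≟V_ = ListP.≡-dec FinP._≟_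

isChildOf : {k : ℕ} → Vertex k → Vertex k → Bool
isChildOf [] v = false
isChildOf (i ∷ w) v = does (w ≟V v)

isRoot : {k : ℕ} → Vertex k → Bool
isRoot [] = true
isRoot (_ ∷ _) = false

b2n : Bool → ℕ
b2n true = 1
b2n false = 0

-- number of edges from v to w in T_k (including the self-loop at the root)
edges : {k : ℕ} → Vertex k → Vertex k → ℕ
edges v w = b2n (isChildOf w v) + b2n (isChildOf v w)
          + (if isRoot v then b2n (isRoot w) else 0)

Config : ℕ → Set
Config k = Vertex k → ℕ

initial : (k : ℕ) → ℕ → Config k
initial k N [] = N
initial k N (_ ∷ _) = 0

fire : (k : ℕ) → Config k → Vertex k → Config k
fire k c v w =
  (if does (w ≟V v) then c w ∸ suc k else c w) + edges v w

CanFire : (k : ℕ) → Config k → Vertex k → Set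
CanFire k c v = suc k ≤ c v

data Run (k : ℕ) : Config k → List (Vertex k) → Config k → Set where
  run-nil  : ∀ {c} → Run k c [] c
  run-cons : ∀ {c v vs c'} → CanFire k c v → Run k (fire k c v) vs c'
           → Run k c (v ∷ vs) c'

Stable : (k : ℕ) → Config k → Set
Stable k c = ∀ v → c v < suc k

Stabilizes : (k N : ℕ) → List (Vertex k) → Set
Stabilizes k N s = Σ (Config k) λ c' → Run k (initial k N) s c' × Stable k c'

rootFires : {k : ℕ} → List (Vertex k) → ℕ
rootFires s = length (filter (λ v → v ≟V []) s)

totalFires : {k : ℕ} → List (Vertex k) → ℕ
totalFires s = length s

{-# OPTIONS --safe #-}
module Submission where

-- By the least action principle, all complete firing sequences from one configuration fire each
-- vertex equally often, so it suffices to exhibit one. Chips dropped at the root keep the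
-- configuration constant on every level of the tree, so whole levels can be fired at once and the
-- process becomes chip-firing on the depths 0, 1, 2, …. Adding k chips at a time, the stable
-- configuration after m·k chips (m ≥ 1) has k chips at the root and the bijective base-k digits
-- of m − 1 below it, and passing from m to m + 1 works like an odometer. If k ∤ m − 1, only the
-- root fires, once. If m − 1 = q·k, the root fires once and then the depths ≥ 1 replay the
-- passage from q to q + 1 one level deeper: a firing at depth ℓ becomes one at depth ℓ + 1, with
-- k times as many vertices, and every root firing brings one extra root firing along. Hence
-- D(m) = 1 + r + k·D(q) and d₀(m) = 1 + r, where r counts the root firings from q to q + 1.

open import Defs
open import Data.Nat using (ℕ; NonZero; zero; suc; _+_; _*_; _∸_; _^_; _≤_; _<_; z≤n; s≤s; s≤s⁻¹)
open import Data.Nat.Properties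
open import Data.Nat.DivMod
open import Data.Nat.Divisibility using (_∣_; divides; _∣?_)
open import Data.Nat.Induction using (<-rec)
open import Data.Nat.ListAction using (sum)
import Data.Nat.ListAction.Properties as Sum
open import Algebra.Properties.CommutativeSemigroup +-commutativeSemigroup
  using (x∙yz≈y∙xz; xy∙z≈xz∙y; x∙yz≈xz∙y) renaming (interchange to +-interchange)
open import Data.Fin using (Fin; zero; suc)
import Data.Fin.Properties as Fin
open import Function using (id)
open import Data.Bool using (true; false; if_then_else_; _∧_)
open import Data.List using (List; []; _∷_; _++_; _∷ʳ_; [_]; length; map; concatMap; allFin)
open import Data.List.Properties
  using (map-++; map-cong; map-∘; map-tabulate; length-++; length-map; length-tabulate)
open import Data.List.Reverse using (Reverse; []; _∶_∶ʳ_; reverseView)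
open import Data.Product using (_×_; _,_; proj₁; proj₂; ∃-syntax)
open import Data.Unit using (⊤; tt)
open import Relation.Binary.Definitions using (DecidableEquality)
open import Relation.Binary.PropositionalEquality hiding ([_])
open import Relation.Nullary using (Dec; yes; no; does; ¬_; contradiction)
open import Relation.Nullary.Decidable using (dec-true; dec-false)

private variable A B : Set

sumBy : (A → ℕ) → List A → ℕ
sumBy f xs = sum (map f xs)

sumBy-++ : ∀ (f : A → ℕ) xs ys → sumBy f (xs ++ ys) ≡ sumBy f xs + sumBy f ys
sumBy-++ f xs ys = trans (cong sum (map-++ f xs ys)) (Sum.sum-++ (map f xs) (map f ys))

sumBy-cong : ∀ {f g : A → ℕ} → f ≗ g → sumBy f ≗ sumBy g
sumBy-cong f≗g xs = cong sum (map-cong f≗g xs)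

sumBy-map : ∀ (f : B → ℕ) (g : A → B) xs → sumBy f (map g xs) ≡ sumBy (λ x → f (g x)) xs
sumBy-map f g xs = cong sum (sym (map-∘ xs))

sumBy-const : ∀ c (xs : List A) → sumBy (λ _ → c) xs ≡ length xs * c
sumBy-const c [] = refl
sumBy-const c (x ∷ xs) = cong (c +_) (sumBy-const c xs)

sumBy-+ : ∀ (f g : A → ℕ) xs → sumBy (λ x → f x + g x) xs ≡ sumBy f xs + sumBy g xs
sumBy-+ f g [] = refl
sumBy-+ f g (x ∷ xs) = trans (cong (f x + g x +_) (sumBy-+ f g xs)) (+-interchange (f x) (g x) _ _)

sumBy-*ˡ : ∀ c (f : A → ℕ) xs → sumBy (λ x → c * f x) xs ≡ c * sumBy f xs
sumBy-*ˡ c f [] = sym (*-zeroʳ c)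
sumBy-*ˡ c f (x ∷ xs) = trans (cong (c * f x +_) (sumBy-*ˡ c f xs)) (sym (*-distribˡ-+ c (f x) _))

sumBy-*ʳ : ∀ c (f : A → ℕ) xs → sumBy (λ x → f x * c) xs ≡ sumBy f xs * c
sumBy-*ʳ c f xs = begin
  sumBy (λ x → f x * c) xs  ≡⟨ sumBy-cong (λ x → *-comm (f x) c) xs ⟩
  sumBy (λ x → c * f x) xs  ≡⟨ sumBy-*ˡ c f xs ⟩
  c * sumBy f xs            ≡⟨ *-comm c _ ⟩
  sumBy f xs * c            ∎
  where open ≡-Reasoning

sumBy-zero : ∀ (xs : List A) → sumBy (λ _ → 0) xs ≡ 0
sumBy-zero xs = trans (sumBy-const 0 xs) (*-zeroʳ (length xs))

sumBy-concatMap : ∀ (f : B → ℕ) (g : A → List B) xs →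
                  sumBy f (concatMap g xs) ≡ sumBy (λ x → sumBy f (g x)) xs
sumBy-concatMap f g [] = refl
sumBy-concatMap f g (x ∷ xs) =
  trans (sumBy-++ f (g x) (concatMap g xs)) (cong (sumBy f (g x) +_) (sumBy-concatMap f g xs))

length≡sumBy : ∀ (xs : List A) → length xs ≡ sumBy (λ _ → 1) xs
length≡sumBy xs = trans (sym (*-identityʳ (length xs))) (sym (sumBy-const 1 xs))

length-concatMap : ∀ (g : A → List B) xs → length (concatMap g xs) ≡ sumBy (λ x → length (g x)) xs
length-concatMap g [] = refl
length-concatMap g (x ∷ xs) = trans (length-++ (g x)) (cong (length (g x) +_) (length-concatMap g xs))

sumBy-allFin-suc : ∀ {n} (f : Fin (suc n) → ℕ) →
                   sumBy f (allFin (suc n)) ≡ f zero + sumBy (λ i → f (suc i)) (allFin n)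
sumBy-allFin-suc {n} f =
  cong (f zero +_) (trans (cong (sumBy f) (sym (map-tabulate id suc))) (sumBy-map f suc (allFin n)))

b2n≤1 : ∀ b → b2n b ≤ 1
b2n≤1 true  = ≤-refl
b2n≤1 false = z≤n

b2n-∧ : ∀ a b → b2n (a ∧ b) ≡ b2n a * b2n b
b2n-∧ true  b = sym (+-identityʳ (b2n b))
b2n-∧ false b = refl

*-b2n : ∀ n b → n * b2n b ≡ (if b then n else 0)
*-b2n n true  = *-identityʳ n
*-b2n n false = *-zeroʳ n

[r+qd]%d≡r : ∀ {r} q {d} .{{_ : NonZero d}} → r < d → (r + q * d) % d ≡ r
[r+qd]%d≡r {r} q {d} r<d = trans ([m+kn]%n≡m%n r q d) (m<n⇒m%n≡m r<d)

[r+qd]/d≡q : ∀ {r} q {d} .{{_ : NonZero d}} → r < d → (r + q * d) / d ≡ q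
[r+qd]/d≡q {r} q {d} r<d =
  trans (+-distrib-/-∣ʳ r (divides q refl)) (cong₂ _+_ (m<n⇒m/n≡0 r<d) (m*n/n≡m q d))

module Multiplicity {A : Set} (_≟_ : DecidableEquality A) where

  count : A → List A → ℕ
  count x = sumBy (λ y → b2n (does (x ≟ y)))

  does-≟-sym : ∀ x y → does (x ≟ y) ≡ does (y ≟ x)
  does-≟-sym x y with x ≟ y | y ≟ x
  ... | yes _   | yes _   = refl
  ... | no _    | no _    = refl
  ... | yes x≡y | no y≢x  = contradiction (sym x≡y) y≢x
  ... | no x≢y  | yes y≡x = contradiction (sym y≡x) x≢y

  count-head : ∀ x xs → count x (x ∷ xs) ≡ suc (count x xs)
  count-head x xs = cong (λ b → b2n b + count x xs) (dec-true (x ≟ x) refl)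

  1≤count-head : ∀ x xs → 1 ≤ count x (x ∷ xs)
  1≤count-head x xs = subst (1 ≤_) (sym (count-head x xs)) (s≤s z≤n)

  remove-one : ∀ u t → 1 ≤ count u t → ∃[ t' ] ∀ (f : A → ℕ) → sumBy f t ≡ f u + sumBy f t'
  remove-one u (y ∷ ys) u∈t with u ≟ y
  ... | yes refl = ys , λ f → refl
  ... | no _ with remove-one u ys u∈t
  ...   | t' , split = y ∷ t' , λ f → trans (cong (f y +_) (split f)) (x∙yz≈y∙xz (f y) (f u) _)

  sumBy-mono-count : ∀ (f : A → ℕ) s t → (∀ x → count x s ≤ count x t) → sumBy f s ≤ sumBy f t
  sumBy-mono-count f [] t _ = z≤n
  sumBy-mono-count f (u ∷ s) t s≤t
    with remove-one u t (≤-trans (1≤count-head u s) (s≤t u))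
  ... | t' , split = begin
    f u + sumBy f s   ≤⟨ +-monoʳ-≤ (f u) (sumBy-mono-count f s t' s≤t') ⟩
    f u + sumBy f t'  ≡⟨ split f ⟨
    sumBy f t         ∎
    where
    open ≤-Reasoning
    s≤t' : ∀ x → count x s ≤ count x t'
    s≤t' x = +-cancelˡ-≤ (b2n (does (x ≟ u))) _ _
               (≤-trans (s≤t x) (≤-reflexive (split (λ y → b2n (does (x ≟ y))))))

  count-∷ʳ : ∀ x p v → count x (p ∷ʳ v) ≡ count x p + b2n (does (x ≟ v))
  count-∷ʳ x p v = trans (sumBy-++ _ p [ v ]) (cong (count x p +_) (+-identityʳ _))

  count-∷ʳ-≤ : ∀ p t v → (∀ x → count x p ≤ count x t) → count v p < count v t →
               ∀ x → count x (p ∷ʳ v) ≤ count x t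
  count-∷ʳ-≤ p t v p≤t v<t x = subst (_≤ count x t) (sym (count-∷ʳ x p v)) (bound (x ≟ v))
    where
    bound : (x≟v : Dec (x ≡ v)) → count x p + b2n (does x≟v) ≤ count x t
    bound (yes refl) = subst (_≤ count x t) (+-comm 1 (count x p)) v<t
    bound (no _)     = subst (_≤ count x t) (sym (+-identityʳ _)) (p≤t x)

count-allFin : ∀ {n} (i : Fin n) → Multiplicity.count Fin._≟_ i (allFin n) ≡ 1
count-allFin {suc n} i = trans (sumBy-allFin-suc (λ j → b2n (does (i Fin.≟ j)))) (by-cases i)
  where
  by-cases : ∀ i → b2n (does (i Fin.≟ zero)) + sumBy (λ j → b2n (does (i Fin.≟ suc j))) (allFin n) ≡ 1
  by-cases zero    = cong suc (sumBy-zero (allFin n))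
  by-cases (suc i) = count-allFin i

module FiringSequences {S : Set} (threshold : ℕ) (fire : (S → ℕ) → S → S → ℕ)
  (fire-cong : ∀ {a b} → a ≗ b → ∀ s → fire a s ≗ fire b s) where

  Legal : (S → ℕ) → List S → Set
  Legal a []       = ⊤
  Legal a (s ∷ ss) = threshold ≤ a s × Legal (fire a s) ss

  fireSeq : (S → ℕ) → List S → S → ℕ
  fireSeq a []       = a
  fireSeq a (s ∷ ss) = fireSeq (fire a s) ss

  -- Configurations are functions, so the end of a firing sequence is only determined up to ≗.
  infix 4 _─[_]→_
  _─[_]→_ : (S → ℕ) → List S → (S → ℕ) → Set
  a ─[ ss ]→ b = Legal a ss × fireSeq a ss ≗ b

  Legal-++⁻ : ∀ a ss ts → Legal a (ss ++ ts) → Legal a ss × Legal (fireSeq a ss) ts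
  Legal-++⁻ a []       ts legal          = tt , legal
  Legal-++⁻ a (s ∷ ss) ts (ready , legal) =
    let ss-legal , ts-legal = Legal-++⁻ (fire a s) ss ts legal in (ready , ss-legal) , ts-legal

  fireSeq-cong : ∀ {a b} ss → a ≗ b → fireSeq a ss ≗ fireSeq b ss
  fireSeq-cong []       a≗b = a≗b
  fireSeq-cong (s ∷ ss) a≗b = fireSeq-cong ss (fire-cong a≗b s)

  Legal-cong : ∀ {a b} ss → a ≗ b → Legal a ss → Legal b ss
  Legal-cong []       a≗b tt              = tt
  Legal-cong (s ∷ ss) a≗b (ready , legal) =
    subst (threshold ≤_) (a≗b s) ready , Legal-cong ss (fire-cong a≗b s) legal

  ─→-respˡ : ∀ {a a' b ss} → a ≗ a' → a ─[ ss ]→ b → a' ─[ ss ]→ b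
  ─→-respˡ {ss = ss} a≗a' (legal , final) =
    Legal-cong ss a≗a' legal , λ s → trans (sym (fireSeq-cong ss a≗a' s)) (final s)

  ─→-respʳ : ∀ {a b b' ss} → b ≗ b' → a ─[ ss ]→ b → a ─[ ss ]→ b'
  ─→-respʳ b≗b' (legal , final) = legal , λ s → trans (final s) (b≗b' s)

  ─→-trans : ∀ {a b c} ss {ts} → a ─[ ss ]→ b → b ─[ ts ]→ c → a ─[ ss ++ ts ]→ c
  ─→-trans []       (tt , a≗b) b→c = ─→-respˡ (λ s → sym (a≗b s)) b→c
  ─→-trans (s ∷ ss) ((ready , legal) , final) b→c =
    let legal' , final' = ─→-trans ss (legal , final) b→c in (ready , legal') , final'

module LevelFiring (k : ℕ) where

  -- What each vertex at depth y receives when every vertex at depth ℓ fires once.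
  levelInflow : ℕ → ℕ → ℕ
  levelInflow zero    y = b2n (does (y ≟ 1)) + b2n (does (y ≟ 0))
  levelInflow (suc ℓ) y = b2n (does (y ≟ suc (suc ℓ))) + (if does (y ≟ ℓ) then k else 0)

  fireLevel : (ℕ → ℕ) → ℕ → ℕ → ℕ
  fireLevel a ℓ y = (if does (y ≟ ℓ) then a y ∸ suc k else a y) + levelInflow ℓ y

  fireLevel-cong : ∀ {a b} → a ≗ b → ∀ ℓ → fireLevel a ℓ ≗ fireLevel b ℓ
  fireLevel-cong a≗b ℓ y =
    cong (λ x → (if does (y ≟ ℓ) then x ∸ suc k else x) + levelInflow ℓ y) (a≗b y)

  open FiringSequences (suc k) fireLevel fireLevel-cong public

  atRoot : ℕ → ℕ → ℕ
  atRoot n zero    = n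
  atRoot n (suc _) = 0

  _⊕_ : (ℕ → ℕ) → (ℕ → ℕ) → ℕ → ℕ
  (a ⊕ e) y = a y + e y

  fireLevel-⊕ : ∀ a e ℓ → suc k ≤ a ℓ → fireLevel (a ⊕ e) ℓ ≗ fireLevel a ℓ ⊕ e
  fireLevel-⊕ a e ℓ ready y with y ≟ ℓ
  ... | yes refl rewrite dec-true (y ≟ y) refl =
    trans (cong (_+ levelInflow y y) (+-∸-comm (e y) ready))
          (xy∙z≈xz∙y (a y ∸ suc k) (e y) (levelInflow y y))
  ... | no y≢ℓ rewrite dec-false (y ≟ ℓ) y≢ℓ = xy∙z≈xz∙y (a y) (e y) _

  ─→-⊕ : ∀ {a b} ρ e → a ─[ ρ ]→ b → a ⊕ e ─[ ρ ]→ b ⊕ e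
  ─→-⊕ []      e (tt , a≗b) = tt , λ y → cong (_+ e y) (a≗b y)
  ─→-⊕ {a} (ℓ ∷ ρ) e ((ready , legal) , final) =
    let legal' , final' =
          ─→-respˡ (λ y → sym (fireLevel-⊕ a e ℓ ready y)) (─→-⊕ ρ e (legal , final))
    in (≤-trans ready (m≤m+n (a ℓ) (e ℓ)) , legal') , final'

  levelTotalFires : List ℕ → ℕ
  levelTotalFires = sumBy (k ^_)

  levelRootFires : List ℕ → ℕ
  levelRootFires = sumBy (λ ℓ → b2n (does (0 ≟ ℓ)))

module TreeFiring (k : ℕ) where

  fire-cong : ∀ {a b : Config k} → a ≗ b → ∀ v → fire k a v ≗ fire k b v
  fire-cong a≗b v w = cong (λ x → (if does (w ≟V v) then x ∸ suc k else x) + edges v w) (a≗b w)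

  open FiringSequences (suc k) (fire k) fire-cong public
  open Multiplicity (_≟V_ {k}) public
  module L = LevelFiring k

  Run⇒─→ : ∀ {c s c'} → Run k c s c' → c ─[ s ]→ c'
  Run⇒─→ run-nil              = tt , λ _ → refl
  Run⇒─→ (run-cons ready run) = let legal , final = Run⇒─→ run in (ready , legal) , final

  Stabilizing : Config k → List (Vertex k) → Set
  Stabilizing c s = Legal c s × Stable k (fireSeq c s)

  Stabilizes⇒Stabilizing : ∀ {N s} → Stabilizes k N s → Stabilizing (initial k N) s
  Stabilizes⇒Stabilizing (c' , run , stable) =
    let legal , final = Run⇒─→ run in legal , λ v → subst (_< suc k) (sym (final v)) (stable v)

  rootFires≡count : ∀ s → rootFires s ≡ count root s
  rootFires≡count []            = refl
  rootFires≡count ([] ∷ s)      = cong suc (rootFires≡count s)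
  rootFires≡count ((_ ∷ _) ∷ s) = rootFires≡count s

  inflow : List (Vertex k) → Vertex k → ℕ
  inflow s w = sumBy (λ u → edges u w) s

  fire-balance : ∀ c v w → suc k ≤ c v → fire k c v w + suc k * b2n (does (w ≟V v)) ≡ c w + edges v w
  fire-balance c v w ready with w ≟V v
  ... | yes refl = begin
    c v ∸ suc k + edges v v + suc k * 1  ≡⟨ xy∙z≈xz∙y (c v ∸ suc k) (edges v v) _ ⟩
    c v ∸ suc k + suc k * 1 + edges v v  ≡⟨ cong (λ x → c v ∸ suc k + x + edges v v) (*-identityʳ (suc k)) ⟩
    c v ∸ suc k + suc k + edges v v      ≡⟨ cong (_+ edges v v) (m∸n+n≡m ready) ⟩
    c v + edges v v                      ∎
    where open ≡-Reasoning
  ... | no _     = trans (cong (c w + edges v w +_) (*-zeroʳ (suc k))) (+-identityʳ _)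

  fireSeq-balance : ∀ {c} s → Legal c s → ∀ w → fireSeq c s w + suc k * count w s ≡ c w + inflow s w
  fireSeq-balance {c} []      _ w = cong (c w +_) (*-zeroʳ (suc k))
  fireSeq-balance {c} (v ∷ s) (ready , legal) w = begin
    X + K * (δ + count w s)            ≡⟨ cong (X +_) (*-distribˡ-+ K δ (count w s)) ⟩
    X + (K * δ + K * count w s)        ≡⟨ x∙yz≈xz∙y X (K * δ) (K * count w s) ⟩
    X + K * count w s + K * δ          ≡⟨ cong (_+ K * δ) (fireSeq-balance s legal w) ⟩
    fire k c v w + inflow s w + K * δ  ≡⟨ xy∙z≈xz∙y (fire k c v w) (inflow s w) (K * δ) ⟩
    fire k c v w + K * δ + inflow s w  ≡⟨ cong (_+ inflow s w) (fire-balance c v w ready) ⟩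
    c w + edges v w + inflow s w       ≡⟨ +-assoc (c w) (edges v w) (inflow s w) ⟩
    c w + inflow (v ∷ s) w             ∎
    where
    open ≡-Reasoning
    K X δ : ℕ
    K = suc k
    X = fireSeq (fire k c v) s w
    δ = b2n (does (w ≟V v))

  module LeastAction {c t} (t-stabilizing : Stabilizing c t) where

    t-legal : Legal c t
    t-legal = proj₁ t-stabilizing

    t-stable : Stable k (fireSeq c t)
    t-stable = proj₂ t-stabilizing

    fireSeq-≤ : ∀ {p} v → Legal c p → (∀ x → count x p ≤ count x t) → count v t ≤ count v p →
                fireSeq c p v ≤ fireSeq c t v
    fireSeq-≤ {p} v p-legal p≤t t≤p = +-cancelʳ-≤ (suc k * count v p) _ _ (begin
      fireSeq c p v + suc k * count v p  ≡⟨ fireSeq-balance p p-legal v ⟩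
      c v + inflow p v                   ≤⟨ +-monoʳ-≤ (c v) (sumBy-mono-count _ p t p≤t) ⟩
      c v + inflow t v                   ≡⟨ fireSeq-balance t t-legal v ⟨
      fireSeq c t v + suc k * count v t  ≤⟨ +-monoʳ-≤ (fireSeq c t v) (*-monoʳ-≤ (suc k) t≤p) ⟩
      fireSeq c t v + suc k * count v p  ∎)
      where open ≤-Reasoning

    -- The vertex fired after a legal p is ready; as t ends stable, t fires it more often than p.
    leastAction : ∀ {p} → Legal c p → ∀ x → count x p ≤ count x t
    leastAction {p} = go (reverseView p)
      where
      go : ∀ {p} → Reverse p → Legal c p → ∀ x → count x p ≤ count x t
      go []             _     _ = z≤n
      go (p ∶ rp ∶ʳ v) legal   =
        let p-legal , (v-ready , _) = Legal-++⁻ c p [ v ] legal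
            p≤t = go rp p-legal
        in count-∷ʳ-≤ p t v p≤t (≰⇒> λ t≤p →
             <⇒≱ (t-stable v) (≤-trans v-ready (fireSeq-≤ v p-legal p≤t t≤p)))

  stabilizing-sums-agree : ∀ {c s t} → Stabilizing c s → Stabilizing c t →
                           ∀ (f : Vertex k → ℕ) → sumBy f s ≡ sumBy f t
  stabilizing-sums-agree {s = s} {t} s-stab t-stab f = ≤-antisym
    (sumBy-mono-count f s t (LeastAction.leastAction t-stab (proj₁ s-stab)))
    (sumBy-mono-count f t s (LeastAction.leastAction s-stab (proj₁ t-stab)))

  children : Vertex k → List (Vertex k)
  children v = map (_∷ v) (allFin k)

  level : ℕ → List (Vertex k)
  level zero    = [ root ]
  level (suc ℓ) = concatMap children (level ℓ)

  count-children : ∀ i w v → count (i ∷ w) (children v) ≡ b2n (does (w ≟V v))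
  count-children i w v = begin
    count (i ∷ w) (children v)
      ≡⟨ sumBy-map _ (_∷ v) (allFin k) ⟩
    sumBy (λ j → b2n (does (i Fin.≟ j) ∧ does (w ≟V v))) (allFin k)
      ≡⟨ sumBy-cong (λ j → b2n-∧ (does (i Fin.≟ j)) _) (allFin k) ⟩
    sumBy (λ j → b2n (does (i Fin.≟ j)) * b2n (does (w ≟V v))) (allFin k)
      ≡⟨ sumBy-*ʳ _ _ (allFin k) ⟩
    Multiplicity.count Fin._≟_ i (allFin k) * b2n (does (w ≟V v))
      ≡⟨ cong (_* _) (count-allFin i) ⟩
    1 * b2n (does (w ≟V v))
      ≡⟨ *-identityˡ _ ⟩
    b2n (does (w ≟V v))
      ∎
    where open ≡-Reasoning

  count-root-children : ∀ v → count root (children v) ≡ 0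
  count-root-children v = trans (sumBy-map _ (_∷ v) (allFin k)) (sumBy-zero (allFin k))

  count-level : ∀ ℓ w → count w (level ℓ) ≡ b2n (does (length w ≟ ℓ))
  count-level zero    []      = refl
  count-level zero    (_ ∷ _) = refl
  count-level (suc ℓ) [] = begin
    count root (concatMap children (level ℓ))            ≡⟨ sumBy-concatMap _ children (level ℓ) ⟩
    sumBy (λ v → count root (children v)) (level ℓ)      ≡⟨ sumBy-cong count-root-children (level ℓ) ⟩
    sumBy (λ _ → 0) (level ℓ)                            ≡⟨ sumBy-zero (level ℓ) ⟩
    0                                                    ∎
    where open ≡-Reasoning
  count-level (suc ℓ) (i ∷ w) = begin
    count (i ∷ w) (concatMap children (level ℓ))         ≡⟨ sumBy-concatMap _ children (level ℓ) ⟩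
    sumBy (λ v → count (i ∷ w) (children v)) (level ℓ)   ≡⟨ sumBy-cong (count-children i w) (level ℓ) ⟩
    count w (level ℓ)                                    ≡⟨ count-level ℓ w ⟩
    b2n (does (length w ≟ ℓ))                            ∎
    where open ≡-Reasoning

  length-level : ∀ ℓ → length (level ℓ) ≡ k ^ ℓ
  length-level zero    = refl
  length-level (suc ℓ) = begin
    length (concatMap children (level ℓ))         ≡⟨ length-concatMap children (level ℓ) ⟩
    sumBy (λ v → length (children v)) (level ℓ)   ≡⟨ sumBy-cong length-children (level ℓ) ⟩
    sumBy (λ _ → k) (level ℓ)                     ≡⟨ sumBy-const k (level ℓ) ⟩
    length (level ℓ) * k                          ≡⟨ cong (_* k) (length-level ℓ) ⟩
    k ^ ℓ * k                                     ≡⟨ *-comm (k ^ ℓ) k ⟩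
    k ^ suc ℓ                                     ∎
    where
    open ≡-Reasoning
    length-children : ∀ v → length (children v) ≡ k
    length-children v = trans (length-map (_∷ v) (allFin k)) (length-tabulate id)

  parents-in-level : ∀ ℓ w →
                     sumBy (λ u → b2n (isChildOf w u)) (level ℓ) ≡ b2n (does (length w ≟ suc ℓ))
  parents-in-level ℓ []      = sumBy-zero (level ℓ)
  parents-in-level ℓ (i ∷ w) = count-level ℓ w

  children-in-level : ∀ ℓ w →
                      sumBy (λ u → b2n (isChildOf u w)) (level (suc ℓ)) ≡ k * b2n (does (length w ≟ ℓ))
  children-in-level ℓ w = begin
    sumBy (λ u → b2n (isChildOf u w)) (level (suc ℓ))
      ≡⟨ sumBy-concatMap _ children (level ℓ) ⟩
    sumBy (λ v → sumBy (λ u → b2n (isChildOf u w)) (children v)) (level ℓ)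
      ≡⟨ sumBy-cong per-vertex (level ℓ) ⟩
    sumBy (λ v → k * b2n (does (w ≟V v))) (level ℓ)
      ≡⟨ sumBy-*ˡ k _ (level ℓ) ⟩
    k * count w (level ℓ)
      ≡⟨ cong (k *_) (count-level ℓ w) ⟩
    k * b2n (does (length w ≟ ℓ))
      ∎
    where
    open ≡-Reasoning
    per-vertex : ∀ v → sumBy (λ u → b2n (isChildOf u w)) (children v) ≡ k * b2n (does (w ≟V v))
    per-vertex v = begin
      sumBy (λ u → b2n (isChildOf u w)) (children v)   ≡⟨ sumBy-map _ (_∷ v) (allFin k) ⟩
      sumBy (λ _ → b2n (does (v ≟V w))) (allFin k)      ≡⟨ sumBy-const _ (allFin k) ⟩
      length (allFin k) * b2n (does (v ≟V w))           ≡⟨ cong (_* b2n (does (v ≟V w))) (length-tabulate {n = k} id) ⟩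
      k * b2n (does (v ≟V w))                           ≡⟨ cong (λ b → k * b2n b) (does-≟-sym v w) ⟩
      k * b2n (does (w ≟V v))                           ∎

  selfLoops : Vertex k → Vertex k → ℕ
  selfLoops w u = if isRoot u then b2n (isRoot w) else 0

  self-loops-in-level : ∀ ℓ w → sumBy (selfLoops w) (level (suc ℓ)) ≡ 0
  self-loops-in-level ℓ w = begin
    sumBy (selfLoops w) (level (suc ℓ))                       ≡⟨ sumBy-concatMap _ children (level ℓ) ⟩
    sumBy (λ v → sumBy (selfLoops w) (children v)) (level ℓ)  ≡⟨ sumBy-cong no-loops (level ℓ) ⟩
    sumBy (λ _ → 0) (level ℓ)                                 ≡⟨ sumBy-zero (level ℓ) ⟩
    0                                                         ∎
    where
    open ≡-Reasoning
    no-loops : ∀ v → sumBy (selfLoops w) (children v) ≡ 0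
    no-loops v = trans (sumBy-map _ (_∷ v) (allFin k)) (sumBy-zero (allFin k))

  inflow-level : ∀ ℓ w → inflow (level ℓ) w ≡ L.levelInflow ℓ (length w)
  inflow-level zero    []          = refl
  inflow-level zero    (_ ∷ [])    = refl
  inflow-level zero    (_ ∷ _ ∷ _) = refl
  inflow-level (suc ℓ) w = begin
    inflow (level (suc ℓ)) w
      ≡⟨ trans (sumBy-+ _ (selfLoops w) lvl) (cong (_+ sumBy (selfLoops w) lvl) (sumBy-+ _ _ lvl)) ⟩
    sumBy (λ u → b2n (isChildOf w u)) lvl + sumBy (λ u → b2n (isChildOf u w)) lvl + sumBy (selfLoops w) lvl
      ≡⟨ cong₂ _+_ (cong₂ _+_ (parents-in-level (suc ℓ) w) (children-in-level ℓ w))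
                   (self-loops-in-level ℓ w) ⟩
    b2n (does (length w ≟ suc (suc ℓ))) + k * b2n (does (length w ≟ ℓ)) + 0
      ≡⟨ trans (+-identityʳ _) (cong (b2n (does (length w ≟ suc (suc ℓ))) +_) (*-b2n k _)) ⟩
    L.levelInflow (suc ℓ) (length w) ∎
    where
    open ≡-Reasoning
    lvl : List (Vertex k)
    lvl = level (suc ℓ)

  Legal-distinct : ∀ {c} s → (∀ w → count w s ≤ 1) → (∀ w → 1 ≤ count w s → suc k ≤ c w) →
                   Legal c s
  Legal-distinct []      _    _     = tt
  Legal-distinct {c} (v ∷ s) once ready =
    ready v (1≤count-head v s) , Legal-distinct s (λ w → ≤-trans (m≤n+m (count w s) _) (once w)) ready'
    where
    v∉s : count v s ≡ 0
    v∉s = n≤0⇒n≡0 (s≤s⁻¹ (subst (_≤ 1) (count-head v s) (once v)))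
    ready' : ∀ w → 1 ≤ count w s → suc k ≤ fire k c v w
    ready' w w∈s with w ≟V v
    ... | yes refl = contradiction (subst (1 ≤_) v∉s w∈s) λ ()
    ... | no _     = ≤-trans (ready w (≤-trans w∈s (m≤n+m (count w s) _))) (m≤m+n (c w) (edges v w))

  onLevels : (ℕ → ℕ) → Config k
  onLevels a v = a (length v)

  level-fires : ∀ a ℓ → suc k ≤ a ℓ → onLevels a ─[ level ℓ ]→ onLevels (L.fireLevel a ℓ)
  level-fires a ℓ ready = legal , final
    where
    in-level : ∀ w → 1 ≤ count w (level ℓ) → length w ≡ ℓ
    in-level w w∈ with length w ≟ ℓ
    ... | yes |w|≡ℓ = |w|≡ℓ
    ... | no |w|≢ℓ  = contradiction (subst (1 ≤_) count≡0 w∈) λ ()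
      where
      count≡0 : count w (level ℓ) ≡ 0
      count≡0 = trans (count-level ℓ w) (cong b2n (dec-false (length w ≟ ℓ) |w|≢ℓ))

    legal : Legal (onLevels a) (level ℓ)
    legal = Legal-distinct (level ℓ)
      (λ w → subst (_≤ 1) (sym (count-level ℓ w)) (b2n≤1 _))
      (λ w w∈ → subst (λ y → suc k ≤ a y) (sym (in-level w w∈)) ready)

    balance : ∀ w → Dec (length w ≡ ℓ) →
              a (length w) + inflow (level ℓ) w ≡ L.fireLevel a ℓ (length w) + suc k * count w (level ℓ)
    balance w (yes |w|≡ℓ)
      rewrite count-level ℓ w | inflow-level ℓ w | dec-true (length w ≟ ℓ) |w|≡ℓ = begin
      a (length w) + e                       ≡⟨ cong (_+ e) (m∸n+n≡m ready') ⟨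
      a (length w) ∸ suc k + suc k + e       ≡⟨ xy∙z≈xz∙y _ (suc k) e ⟩
      a (length w) ∸ suc k + e + suc k       ≡⟨ cong (a (length w) ∸ suc k + e +_) (*-identityʳ (suc k)) ⟨
      a (length w) ∸ suc k + e + suc k * 1   ∎
      where
      open ≡-Reasoning
      e : ℕ
      e = L.levelInflow ℓ (length w)
      ready' : suc k ≤ a (length w)
      ready' = subst (λ y → suc k ≤ a y) (sym |w|≡ℓ) ready
    balance w (no |w|≢ℓ)
      rewrite count-level ℓ w | inflow-level ℓ w | dec-false (length w ≟ ℓ) |w|≢ℓ =
      sym (trans (cong (a (length w) + L.levelInflow ℓ (length w) +_) (*-zeroʳ (suc k))) (+-identityʳ _))

    final : ∀ w → fireSeq (onLevels a) (level ℓ) w ≡ L.fireLevel a ℓ (length w)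
    final w = +-cancelʳ-≡ (suc k * count w (level ℓ)) _ _
                (trans (fireSeq-balance (level ℓ) legal w) (balance w (length w ≟ ℓ)))

  lift-─→ : ∀ {a b} ρ → a L.─[ ρ ]→ b → onLevels a ─[ concatMap level ρ ]→ onLevels b
  lift-─→ []      (tt , a≗b) = tt , λ v → a≗b (length v)
  lift-─→ {a} (ℓ ∷ ρ) ((ready , legal) , final) =
    ─→-trans (level ℓ) (level-fires a ℓ ready) (lift-─→ ρ (legal , final))

  length-lift : ∀ ρ → length (concatMap level ρ) ≡ L.levelTotalFires ρ
  length-lift ρ = trans (length-concatMap level ρ) (sumBy-cong length-level ρ)

  count-root-lift : ∀ ρ → count root (concatMap level ρ) ≡ L.levelRootFires ρ
  count-root-lift ρ = trans (sumBy-concatMap _ level ρ) (sumBy-cong (λ ℓ → count-level ℓ root) ρ)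

  lifted-fires : ∀ {N s ρ b} → Stabilizes k N s → L.atRoot N L.─[ ρ ]→ b → (∀ y → b y ≤ k) →
                 totalFires s ≡ L.levelTotalFires ρ × rootFires s ≡ L.levelRootFires ρ
  lifted-fires {N} {s} {ρ} {b} s-stabilizes N→b b-stable =
      trans (length≡sumBy s) (trans (agree (λ _ → 1)) (trans (sym (length≡sumBy t)) (length-lift ρ)))
    , trans (rootFires≡count s) (trans (agree (λ v → b2n (does (root ≟V v)))) (count-root-lift ρ))
    where
    t : List (Vertex k)
    t = concatMap level ρ
    initial≗onLevels : initial k N ≗ onLevels (L.atRoot N)
    initial≗onLevels []      = refl
    initial≗onLevels (_ ∷ _) = refl
    t-reaches : initial k N ─[ t ]→ onLevels b
    t-reaches = ─→-respˡ (λ v → sym (initial≗onLevels v)) (lift-─→ ρ N→b)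
    t-stabilizing : Stabilizing (initial k N) t
    t-stabilizing =
      proj₁ t-reaches , λ v → s≤s (subst (_≤ k) (sym (proj₂ t-reaches v)) (b-stable (length v)))
    agree : ∀ f → sumBy f s ≡ sumBy f t
    agree = stabilizing-sums-agree (Stabilizes⇒Stabilizing s-stabilizes) t-stabilizing

module Odometer (k-2 : ℕ) where

  k-1 : ℕ
  k-1 = suc k-2

  k : ℕ
  k = suc k-1

  open LevelFiring k public
  open TreeFiring k using (lifted-fires)

  bijDigit : ℕ → ℕ → ℕ
  bijDigit zero    _       = 0
  bijDigit (suc n) zero    = suc (n % k)
  bijDigit (suc n) (suc y) = bijDigit (n / k) y

  -- The stable configuration reached from m·k chips at the root, m ≥ 1: k at the root, at depth y + 1
  -- digit y of m − 1 in bijective base k (digits 1, …, k, least significant first).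
  stableLevels : ℕ → ℕ → ℕ
  stableLevels zero    _       = 0
  stableLevels (suc m) zero    = k
  stableLevels (suc m) (suc y) = bijDigit m y

  bijDigit≤k : ∀ n y → bijDigit n y ≤ k
  bijDigit≤k zero    _       = z≤n
  bijDigit≤k (suc n) zero    = m%n<n n k
  bijDigit≤k (suc n) (suc y) = bijDigit≤k (n / k) y

  stableLevels≤k : ∀ m y → stableLevels m y ≤ k
  stableLevels≤k zero    _       = z≤n
  stableLevels≤k (suc m) zero    = ≤-refl
  stableLevels≤k (suc m) (suc y) = bijDigit≤k m y

  bijDigit-*k : ∀ q → bijDigit (q * k) ≗ stableLevels q
  bijDigit-*k zero    _       = refl
  bijDigit-*k (suc q) zero    = cong suc ([r+qd]%d≡r {k-1} q ≤-refl)
  bijDigit-*k (suc q) (suc y) = cong (λ n → bijDigit n y) ([r+qd]/d≡q {k-1} q ≤-refl)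

  no-carry : ∀ p → ¬ k ∣ suc p → suc (p % k) < k
  no-carry p k∤1+p = ≤∧≢⇒< (m%n<n p k) λ 1+r≡k → k∤1+p (divides (suc (p / k)) (begin
    suc p                   ≡⟨ cong suc (m≡m%n+[m/n]*n p k) ⟩
    suc (p % k) + p / k * k ≡⟨ cong (_+ p / k * k) 1+r≡k ⟩
    suc (p / k) * k         ∎))
    where open ≡-Reasoning

  bijDigit-suc : ∀ n → ¬ k ∣ n → bijDigit (suc n) 0 ≡ suc (bijDigit n 0)
                                × (∀ y → bijDigit (suc n) (suc y) ≡ bijDigit n (suc y))
  bijDigit-suc zero    k∤0   = contradiction (divides 0 refl) k∤0
  bijDigit-suc (suc p) k∤1+p =
      cong suc (trans (cong (_% k) 1+p≡) ([r+qd]%d≡r (p / k) r<k))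
    , λ y → cong (λ n → bijDigit n y) (trans (cong (_/ k) 1+p≡) ([r+qd]/d≡q (p / k) r<k))
    where
    r<k : suc (p % k) < k
    r<k = no-carry p k∤1+p
    1+p≡ : suc p ≡ suc (p % k) + p / k * k
    1+p≡ = cong suc (m≡m%n+[m/n]*n p k)

  -- The depths ≥ 1 replaying a process one level deeper: the vertices of depth 1 play its root,
  -- holding k − 1 chips fewer, while the real root waits with k chips.
  shift : (ℕ → ℕ) → ℕ → ℕ
  shift a zero          = k
  shift a (suc zero)    = a 0 ∸ k-1
  shift a (suc (suc y)) = a (suc y)

  shift-cong : ∀ {a b} → a ≗ b → shift a ≗ shift b
  shift-cong a≗b zero          = refl
  shift-cong a≗b (suc zero)    = cong (_∸ k-1) (a≗b 0)
  shift-cong a≗b (suc (suc y)) = a≗b (suc y)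

  -- A root firing is replayed by firing depth 1 and then the root: the k chips sent up let the root
  -- fire, and the chip it passes back to each vertex of depth 1 stands for the replayed self-loop.
  stepRun : ℕ → List ℕ
  stepRun zero    = 1 ∷ 0 ∷ []
  stepRun (suc ℓ) = [ suc (suc ℓ) ]

  shiftRun : List ℕ → List ℕ
  shiftRun = concatMap stepRun

  PositiveMultiple : ℕ → Set
  PositiveMultiple n = ∃[ t ] n ≡ suc t * k

  root-refill : k + k ∸ suc k + 1 ≡ k
  root-refill = begin
    k + k ∸ suc k + 1         ≡⟨ cong (λ x → suc x ∸ suc k + 1) (+-suc k-1 k-1) ⟩
    suc k + k-1 ∸ suc k + 1   ≡⟨ cong (_+ 1) (m+n∸m≡n (suc k) k-1) ⟩
    k-1 + 1                   ≡⟨ +-comm k-1 1 ⟩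
    k                         ∎
    where open ≡-Reasoning

  root-ready : suc k ≤ k + k
  root-ready = s≤s (m≤n+m k k-1)

  -- The replayed root holds a positive multiple of k chips, so whenever it can fire it holds at
  -- least 2k and depth 1 can fire too.
  shift-step : ∀ {a} ℓ → PositiveMultiple (a 0) → suc k ≤ a ℓ →
               shift a ─[ stepRun ℓ ]→ shift (fireLevel a ℓ) × PositiveMultiple (fireLevel a ℓ 0)
  shift-step zero (zero , a0≡k) ready =
    contradiction (subst (suc k ≤_) (trans a0≡k (+-identityʳ k)) ready) 1+n≰n
  shift-step {a} zero (suc t , a0≡) ready = ((level1-ready , root-ready , tt) , final) , t , refilled
    where
    X : ℕ
    X = t * k
    level1 : a 0 ∸ k-1 ≡ suc k + X
    level1 = trans (cong (_∸ k-1) (trans a0≡ (sym (+-suc k-1 (k + X))))) (m+n∸m≡n k-1 (suc k + X))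
    drained : a 0 ∸ suc k ≡ k-1 + X
    drained = trans (cong (_∸ suc k) (trans a0≡ (cong suc (+-suc k-1 (k-1 + X))))) (m+n∸m≡n (suc k) (k-1 + X))
    level1-ready : suc k ≤ a 0 ∸ k-1
    level1-ready = subst (suc k ≤_) (sym level1) (m≤m+n (suc k) X)
    refilled : a 0 ∸ suc k + 1 ≡ suc t * k
    refilled = trans (cong (_+ 1) drained) (+-comm (k-1 + X) 1)
    final : fireSeq (shift a) (stepRun 0) ≗ shift (fireLevel a 0)
    final zero                = root-refill
    final (suc zero)          = begin
      a 0 ∸ k-1 ∸ suc k + 0 + 1  ≡⟨ cong (λ x → x ∸ suc k + 0 + 1) level1 ⟩
      suc k + X ∸ suc k + 0 + 1  ≡⟨ cong (λ x → x + 0 + 1) (m+n∸m≡n (suc k) X) ⟩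
      X + 0 + 1                  ≡⟨ cong (_+ 1) (+-identityʳ X) ⟩
      X + 1                      ≡⟨ m+n∸m≡n k-1 (X + 1) ⟨
      k-1 + (X + 1) ∸ k-1        ≡⟨ cong (_∸ k-1) (+-assoc k-1 X 1) ⟨
      k-1 + X + 1 ∸ k-1          ≡⟨ cong (λ x → x + 1 ∸ k-1) drained ⟨
      a 0 ∸ suc k + 1 ∸ k-1      ∎
      where open ≡-Reasoning
    final (suc (suc zero))    = +-identityʳ _
    final (suc (suc (suc y))) = +-identityʳ _
  shift-step {a} (suc ℓ) (t , a0≡) ready = ((ready , tt) , final) , root-multiple ℓ
    where
    k-1≤a0 : k-1 ≤ a 0
    k-1≤a0 = subst (k-1 ≤_) (sym a0≡) (≤-trans (n≤1+n k-1) (m≤m+n k (t * k)))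
    final : fireLevel (shift a) (suc (suc ℓ)) ≗ shift (fireLevel a (suc ℓ))
    final zero          = +-identityʳ k
    final (suc zero)    = sym (+-∸-comm _ k-1≤a0)
    final (suc (suc y)) = refl
    root-multiple : ∀ ℓ → PositiveMultiple (a 0 + (if does (0 ≟ ℓ) then k else 0))
    root-multiple zero    = suc t , trans (cong (_+ k) a0≡) (+-comm (suc t * k) k)
    root-multiple (suc _) = t , trans (+-identityʳ _) a0≡

  shift-simulates : ∀ {a b} ρ → PositiveMultiple (a 0) → a ─[ ρ ]→ b →
                    shift a ─[ shiftRun ρ ]→ shift b
  shift-simulates []      _  (tt , a≗b) = tt , shift-cong a≗b
  shift-simulates (ℓ ∷ ρ) a0 ((ready , legal) , final) =
    let step , a0' = shift-step ℓ a0 ready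
    in ─→-trans (stepRun ℓ) step (shift-simulates ρ a0' (legal , final))

  levelRootFires-shiftRun : ∀ ρ → levelRootFires (shiftRun ρ) ≡ levelRootFires ρ
  levelRootFires-shiftRun ρ = trans (sumBy-concatMap _ stepRun ρ) (sumBy-cong per-step ρ)
    where
    per-step : ∀ ℓ → levelRootFires (stepRun ℓ) ≡ b2n (does (0 ≟ ℓ))
    per-step zero    = refl
    per-step (suc _) = refl

  levelTotalFires-shiftRun : ∀ ρ → levelTotalFires (shiftRun ρ) ≡ levelRootFires ρ + k * levelTotalFires ρ
  levelTotalFires-shiftRun ρ = begin
    levelTotalFires (shiftRun ρ)                    ≡⟨ sumBy-concatMap _ stepRun ρ ⟩
    sumBy (λ ℓ → levelTotalFires (stepRun ℓ)) ρ     ≡⟨ sumBy-cong per-step ρ ⟩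
    sumBy (λ ℓ → b2n (does (0 ≟ ℓ)) + k * k ^ ℓ) ρ  ≡⟨ sumBy-+ _ _ ρ ⟩
    levelRootFires ρ + sumBy (λ ℓ → k * k ^ ℓ) ρ    ≡⟨ cong (levelRootFires ρ +_) (sumBy-*ˡ k _ ρ) ⟩
    levelRootFires ρ + k * levelTotalFires ρ        ∎
    where
    open ≡-Reasoning
    per-step : ∀ ℓ → levelTotalFires (stepRun ℓ) ≡ b2n (does (0 ≟ ℓ)) + k * k ^ ℓ
    per-step zero    = +-comm (k * 1) 1
    per-step (suc ℓ) = +-identityʳ _

  Increment : ℕ → List ℕ → Set
  Increment m ρ = stableLevels m ⊕ atRoot k ─[ ρ ]→ stableLevels (suc m)

  increment-zero : Increment 0 []
  increment-zero = tt , final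
    where
    final : stableLevels 0 ⊕ atRoot k ≗ stableLevels 1
    final zero    = refl
    final (suc _) = refl

  increment-no-carry : ∀ n → ¬ k ∣ n → Increment (suc n) [ 0 ]
  increment-no-carry n k∤n = (root-ready , tt) , final
    where
    final : fireLevel (stableLevels (suc n) ⊕ atRoot k) 0 ≗ stableLevels (suc (suc n))
    final zero          = root-refill
    final (suc zero)    = trans (cong (_+ 1) (+-identityʳ _))
                                (trans (+-comm (bijDigit n 0) 1) (sym (proj₁ (bijDigit-suc n k∤n))))
    final (suc (suc y)) = trans (+-identityʳ _)
                                (trans (+-identityʳ _) (sym (proj₂ (bijDigit-suc n k∤n) y)))

  increment-carry : ∀ q {ρ} → Increment q ρ → Increment (suc (q * k)) (0 ∷ shiftRun ρ)
  increment-carry q {ρ} q-increment =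
    ─→-trans [ 0 ] ((root-ready , tt) , root-fired)
      (─→-respʳ carried (shift-simulates ρ (root-multiple q) q-increment))
    where
    root-fired : fireLevel (stableLevels (suc (q * k)) ⊕ atRoot k) 0 ≗ shift (stableLevels q ⊕ atRoot k)
    root-fired zero          = root-refill
    root-fired (suc zero)    = begin
      bijDigit (q * k) 0 + 0 + 1   ≡⟨ cong (λ x → x + 0 + 1) (bijDigit-*k q 0) ⟩
      stableLevels q 0 + 0 + 1     ≡⟨ cong (_+ 1) (+-identityʳ _) ⟩
      stableLevels q 0 + 1         ≡⟨ cong (stableLevels q 0 +_) (m+n∸n≡m 1 k-1) ⟨
      stableLevels q 0 + (k ∸ k-1) ≡⟨ +-∸-assoc (stableLevels q 0) (n≤1+n k-1) ⟨
      stableLevels q 0 + k ∸ k-1   ∎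
      where open ≡-Reasoning
    root-fired (suc (suc y)) = trans (+-identityʳ _) (cong (_+ 0) (bijDigit-*k q (suc y)))
    root-multiple : ∀ q → PositiveMultiple (stableLevels q 0 + k)
    root-multiple zero    = 0 , sym (+-identityʳ k)
    root-multiple (suc _) = 1 , cong (k +_) (sym (+-identityʳ k))
    carried : shift (stableLevels (suc q)) ≗ stableLevels (suc (suc (q * k)))
    carried zero          = refl
    carried (suc zero)    = trans (m+n∸n≡m 1 k-1) (sym (cong suc (m*n%n≡0 q k)))
    carried (suc (suc y)) = sym (cong (λ n → bijDigit n y) (m*n/n≡m q k))

  increment : ∀ m → ∃[ ρ ] Increment m ρ
  increment = <-rec (λ m → ∃[ ρ ] Increment m ρ) step
    where
    step : ∀ m → (∀ {q} → q < m → ∃[ ρ ] Increment q ρ) → ∃[ ρ ] Increment m ρ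
    step zero    _   = [] , increment-zero
    step (suc n) rec with k ∣? n
    ... | no k∤n             = [ 0 ] , increment-no-carry n k∤n
    ... | yes (divides q refl) =
      let ρ , q-increment = rec (s≤s (m≤m*n q k)) in 0 ∷ shiftRun ρ , increment-carry q q-increment

  atRoot-+ : ∀ m n → atRoot m ⊕ atRoot n ≗ atRoot (n + m)
  atRoot-+ m n zero    = +-comm m n
  atRoot-+ m n (suc _) = refl

  stabilization-suc : ∀ m {P ρ} → atRoot (m * k) ─[ P ]→ stableLevels m → Increment m ρ →
                   atRoot (suc m * k) ─[ P ++ ρ ]→ stableLevels (suc m)
  stabilization-suc m {P} P-run increment-run =
    ─→-respˡ (atRoot-+ (m * k) k) (─→-trans P (─→-⊕ P (atRoot k) P-run) increment-run)

  stabilization : ∀ m → ∃[ P ] atRoot (m * k) ─[ P ]→ stableLevels m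
  stabilization zero    = [] , tt , λ { zero → refl ; (suc _) → refl }
  stabilization (suc m) =
    let P , P-run = stabilization m
        ρ , increment-run = increment m
    in P ++ ρ , stabilization-suc m P-run increment-run

  fires-after-increment : ∀ {m s₀ s₁ ρ} →
    Stabilizes k (m * k) s₀ → Stabilizes k ((m + 1) * k) s₁ → Increment m ρ →
    totalFires s₁ ≡ totalFires s₀ + levelTotalFires ρ × rootFires s₁ ≡ rootFires s₀ + levelRootFires ρ
  fires-after-increment {m} {s₀} {s₁} {ρ} s₀-stab s₁-stab increment-run =
      trans (proj₁ fires₁) (trans (sumBy-++ _ P ρ) (cong (_+ levelTotalFires ρ) (sym (proj₁ fires₀))))
    , trans (proj₂ fires₁) (trans (sumBy-++ _ P ρ) (cong (_+ levelRootFires ρ) (sym (proj₂ fires₀))))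
    where
    P : List ℕ
    P = proj₁ (stabilization m)
    P-run : atRoot (m * k) ─[ P ]→ stableLevels m
    P-run = proj₂ (stabilization m)
    fires₀ : totalFires s₀ ≡ levelTotalFires P × rootFires s₀ ≡ levelRootFires P
    fires₀ = lifted-fires s₀-stab P-run (stableLevels≤k m)
    fires₁ : totalFires s₁ ≡ levelTotalFires (P ++ ρ) × rootFires s₁ ≡ levelRootFires (P ++ ρ)
    fires₁ = lifted-fires (subst (λ n → Stabilizes k (n * k) s₁) (+-comm m 1) s₁-stab)
                          (stabilization-suc m P-run increment-run) (stableLevels≤k (suc m))

  levelTotalFires-carry : ∀ ρ →
    levelTotalFires (0 ∷ shiftRun ρ) ≡ levelRootFires (0 ∷ shiftRun ρ) + k * levelTotalFires ρ
  levelTotalFires-carry ρ = cong suc (trans (levelTotalFires-shiftRun ρ)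
                                            (cong (_+ k * levelTotalFires ρ) (sym (levelRootFires-shiftRun ρ))))

-- Imported only here: its prefix +_ makes sections such as (n +_) ambiguous.
open import Data.Integer using (+_; _-_) renaming (_+_ to _+ℤ_; _*_ to _*ℤ_)
import Data.Integer.Properties as ℤ

+-difference : ∀ {a b c} → a ≡ b + c → + a - + b ≡ + c
+-difference {b = b} {c} refl =
  trans (ℤ.[+m]-[+n]≡m⊖n (b + c) b) (trans (ℤ.⊖-≥ (m≤m+n b c)) (cong +_ (m+n∸m≡n b c)))

mainTheorem16 : (k : ℕ) → 2 ≤ k → (m : ℕ) → 1 ≤ m →
    (s₀ s₁ : List (Vertex k)) →
    Stabilizes k (m * k) s₀ → Stabilizes k ((m + 1) * k) s₁ →
    ((q : ℕ) → m ∸ 1 ≡ q * k →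
      (t₀ t₁ : List (Vertex k)) →
      Stabilizes k (q * k) t₀ → Stabilizes k ((q + 1) * k) t₁ →
      + totalFires s₁ - + totalFires s₀
        ≡ (+ rootFires s₁ - + rootFires s₀)
          +ℤ (+ k) *ℤ (+ totalFires t₁ - + totalFires t₀))
    × (¬ (k ∣ m ∸ 1) → + totalFires s₁ - + totalFires s₀ ≡ + 1)
mainTheorem16 (suc (suc k-2)) (s≤s (s≤s z≤n)) (suc n) (s≤s z≤n) s₀ s₁ s₀-stab s₁-stab =
  (λ q n≡qk t₀ t₁ t₀-stab t₁-stab →
    let ρ , q-increment = increment q
        m-increment = subst (λ n → Increment (suc n) (0 ∷ shiftRun ρ)) (sym n≡qk)
                            (increment-carry q q-increment)
        total-m , root-m = fires-after-increment s₀-stab s₁-stab m-increment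
        total-q , _ = fires-after-increment t₀-stab t₁-stab q-increment
    in begin
      + totalFires s₁ - + totalFires s₀
        ≡⟨ +-difference total-m ⟩
      + levelTotalFires (0 ∷ shiftRun ρ)
        ≡⟨ cong +_ (levelTotalFires-carry ρ) ⟩
      + (levelRootFires (0 ∷ shiftRun ρ) + k * levelTotalFires ρ)
        ≡⟨ trans (ℤ.pos-+ (levelRootFires (0 ∷ shiftRun ρ)) (k * levelTotalFires ρ))
                 (cong (+ levelRootFires (0 ∷ shiftRun ρ) +ℤ_) (ℤ.pos-* k (levelTotalFires ρ))) ⟩
      + levelRootFires (0 ∷ shiftRun ρ) +ℤ + k *ℤ + levelTotalFires ρ
        ≡⟨ cong₂ (λ x y → x +ℤ + k *ℤ y) (+-difference {b = rootFires s₀} root-m)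
                                          (+-difference {b = totalFires t₀} total-q) ⟨
      (+ rootFires s₁ - + rootFires s₀) +ℤ (+ k) *ℤ (+ totalFires t₁ - + totalFires t₀) ∎)
  , λ k∤n → +-difference {b = totalFires s₀}
               (proj₁ (fires-after-increment s₀-stab s₁-stab (increment-no-carry n k∤n)))
  where
  open Odometer k-2
  open ≡-Reasoning
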